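{- Let $H_1,H_2$ be finite groups, $F_n$ the free profinite group on $n$ generators, and $G_1\trianglelefteq H_1$, $G_2\trianglelefteq H_2$ normal subgroups. Let $$S_{G_1,G_2}=\{(\phi_1,\phi_2)\in\operatorname{Sur}(F_n,H_1)\times\operatorname{Sur}(F_n,H_2):\ \phi_1(\ker\phi_2)=G_1\text{ and }\phi_2(\ker\phi_1)=G_2\}.$$ Then $|S_{G_1,G_2}|\le|H_1|^n|G_2|^n|H_2|^r$, where $r=\operatorname{rank}(H_1)$.
   Context: $\operatorname{Sur}(F_n,H)$ is the set of continuous surjective homomorphisms $F_n\to H$; $\operatorname{rank}(H_1)$ is the minimal number of generators of $H_1$. -}

module Defs where

open import Level using (0ℓ)
open import Algebra.Bundles using (Group)
open import Data.Nat using (ℕ; _≤_)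
open import Data.Fin using (Fin)
open import Data.Fin.Subset using (Subset; _∈_; ∣_∣)
open import Data.Bool using (Bool; true; false)
open import Data.List using (List; []; _∷_)
open import Data.Vec using (Vec; lookup)
open import Data.Product using (_×_; _,_; ∃; ∃-syntax; Σ)
open import Relation.Binary.PropositionalEquality using (_≡_)
open import Function.Bundles using (_⇔_)

record FiniteGroup : Set₁ where
  field
    group     : Group 0ℓ 0ℓ
  open Group group public
  field
    size      : ℕ
    enum      : Fin size → Carrier
    enum-surj : ∀ x → ∃[ i ] (enum i ≈ x)
    enum-inj  : ∀ i j → enum i ≈ enum j → i ≡ j

order : FiniteGroup → ℕ
order H = FiniteGroup.size H

-- Words in the free group on m generators (unreduced words; (i , true) is
-- the generator x_i, (i , false) its inverse).
Word : ℕ → Set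
Word m = List (Fin m × Bool)

module _ (H : FiniteGroup) where
  open FiniteGroup H

  eval : ∀ {m} → (Fin m → Carrier) → Word m → Carrier
  eval t []                = ε
  eval t ((i , true)  ∷ w) = t i ∙ eval t w
  eval t ((i , false) ∷ w) = (t i ⁻¹) ∙ eval t w

  Generates : ∀ {m} → (Fin m → Carrier) → Set
  Generates t = ∀ x → ∃[ w ] (eval t w ≈ x)

  IsRank : ℕ → Set
  IsRank r = (Σ (Fin r → Carrier) Generates)
           × (∀ m (t : Fin m → Carrier) → Generates t → r ≤ m)

  Mem : Subset size → Carrier → Set
  Mem G x = ∃[ i ] (i ∈ G × enum i ≈ x)

  record IsNormalSubgroup (G : Subset size) : Set where
    field
      ε-mem   : Mem G ε
      ∙-mem   : ∀ {x y} → Mem G x → Mem G y → Mem G (x ∙ y)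
      ⁻¹-mem  : ∀ {x} → Mem G x → Mem G (x ⁻¹)
      conj-mem : ∀ {x} g → Mem G x → Mem G ((g ∙ x) ∙ (g ⁻¹))

  -- The homomorphism F_n → H encoded by a vector of element indices.
  hom : ∀ {n} → Vec (Fin size) n → (Fin n → Carrier)
  hom v i = enum (lookup v i)

  IsSur : ∀ {n} → Vec (Fin size) n → Set
  IsSur v = Generates (hom v)

card : ∀ {k} → Subset k → ℕ
card G = ∣ G ∣

ImageOfKernelIs : (H₁ H₂ : FiniteGroup) {n : ℕ}
  → Vec (Fin (FiniteGroup.size H₁)) n → Vec (Fin (FiniteGroup.size H₂)) n
  → Subset (FiniteGroup.size H₁) → Set
ImageOfKernelIs H₁ H₂ v₁ v₂ G₁ =
  ∀ x → Mem H₁ G₁ x ⇔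
        (∃[ w ] ( FiniteGroup._≈_ H₂ (eval H₂ (hom H₂ v₂) w) (FiniteGroup.ε H₂)
                × FiniteGroup._≈_ H₁ (eval H₁ (hom H₁ v₁) w) x))

InS : (H₁ H₂ : FiniteGroup) (G₁ : Subset (FiniteGroup.size H₁))
      (G₂ : Subset (FiniteGroup.size H₂)) (n : ℕ)
  → Vec (Fin (FiniteGroup.size H₁)) n × Vec (Fin (FiniteGroup.size H₂)) n → Set
InS H₁ H₂ G₁ G₂ n (v₁ , v₂) =
  IsSur H₁ v₁ × IsSur H₂ v₂
  × ImageOfKernelIs H₁ H₂ v₁ v₂ G₁
  × ImageOfKernelIs H₂ H₁ v₂ v₁ G₂

-- Fix generators t₁ … t_r of H₁. For (φ₁ , φ₂) ∈ S lift each t_j to a word W_j with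
-- φ₁(W_j) = t_j, write φ₁(x_i) as a word in the t_j and substitute the W_j, obtaining a word U_i
-- with φ₁(U_i) = φ₁(x_i). Then x_i U_i⁻¹ ∈ ker φ₁, so φ₂(x_i U_i⁻¹) ∈ G₂, and
-- φ₂(x_i) = φ₂(x_i U_i⁻¹) φ₂(U_i) where φ₂(U_i) depends only on the φ₂(W_j). Hence the pair is
-- determined by φ₁ ∈ H₁ⁿ, (φ₂(x_i U_i⁻¹))_i ∈ G₂ⁿ and (φ₂(W_j))_j ∈ H₂ʳ.
module Submission where

open import Defs
open import Data.Nat using (ℕ; _≤_; _*_; _^_)
open import Data.Fin using (Fin)
open import Data.Fin.Subset using (Subset)
open import Data.Vec using (Vec)
open import Data.Product using (_×_)
open import Data.List using (List; length)
open import Data.List.Relation.Unary.All using (All)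
open import Data.List.Relation.Unary.Unique.Propositional using (Unique)

open import Level using (Level)
open import Data.Bool using (true; false; not)
open import Data.Fin as Fin using (zero; suc; combine; funToFin; finToFun)
open import Data.Fin.Properties using (combine-injective; finToFun-funToFin; injective⇒≤; suc-injective)
open import Data.Fin.Subset using (inside; outside; ∣_∣) renaming (_∈_ to _∈ˢ_)
open import Data.Vec as Vec using (_∷_; here; there)
open import Data.Vec.Properties using (≡-dec; tabulate∘lookup; tabulate-cong)
open import Data.List as List using ([]; _∷_; _++_)
open import Data.List.Relation.Unary.All as All using (_∷_)
import Data.List.Relation.Unary.All.Properties as All
open import Data.List.Relation.Unary.AllPairs using (_∷_)
import Data.List.Relation.Unary.Any as Any
open import Data.List.Membership.Propositional using (_∈_)
open import Data.List.Membership.Propositional.Properties using (∈-lookup; ∈-map⁺)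
open import Data.Product using (_,_; proj₁; proj₂)
open import Data.Empty using (⊥-elim)
open import Relation.Nullary using (yes; no)
open import Relation.Binary.Definitions using (DecidableEquality)
open import Relation.Binary.PropositionalEquality as ≡ using (_≡_; _≗_)
open import Function.Bundles using (Equivalence)

private
  variable
    a : Level
    A : Set a
    k m n r N : ℕ

invertWord : Word m → Word m
invertWord []            = []
invertWord ((i , b) ∷ w) = invertWord w ++ ((i , not b) ∷ [])

substituteWord : (Fin k → Word m) → Word k → Word m
substituteWord W []                 = []
substituteWord W ((j , true)  ∷ u) = W j ++ substituteWord W u
substituteWord W ((j , false) ∷ u) = invertWord (W j) ++ substituteWord W u

module _ (H : FiniteGroup) where
  open FiniteGroup H
  open import Algebra.Properties.Group group using (ε⁻¹≈ε; ⁻¹-involutive; ⁻¹-anti-homo-∙; ∙-cancelʳ)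

  eval-++ : (φ : Fin m → Carrier) (w w′ : Word m) →
            eval H φ (w ++ w′) ≈ eval H φ w ∙ eval H φ w′
  eval-++ φ []                w′ = sym (identityˡ _)
  eval-++ φ ((i , true)  ∷ w) w′ = trans (∙-congˡ (eval-++ φ w w′)) (sym (assoc _ _ _))
  eval-++ φ ((i , false) ∷ w) w′ = trans (∙-congˡ (eval-++ φ w w′)) (sym (assoc _ _ _))

  eval-invertWord : (φ : Fin m → Carrier) (w : Word m) →
                    eval H φ (invertWord w) ≈ eval H φ w ⁻¹
  eval-invertWord φ [] = sym ε⁻¹≈ε
  eval-invertWord φ ((i , true) ∷ w) = trans (eval-++ φ (invertWord w) _)
    (trans (∙-cong (eval-invertWord φ w) (identityʳ _)) (sym (⁻¹-anti-homo-∙ _ _)))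
  eval-invertWord φ ((i , false) ∷ w) = trans (eval-++ φ (invertWord w) _)
    (trans (∙-cong (eval-invertWord φ w) (trans (identityʳ _) (sym (⁻¹-involutive _))))
           (sym (⁻¹-anti-homo-∙ _ _)))

  eval-cong : {φ ψ : Fin m → Carrier} → (∀ i → φ i ≈ ψ i) →
              (w : Word m) → eval H φ w ≈ eval H ψ w
  eval-cong φ≈ψ []                = refl
  eval-cong φ≈ψ ((i , true)  ∷ w) = ∙-cong (φ≈ψ i) (eval-cong φ≈ψ w)
  eval-cong φ≈ψ ((i , false) ∷ w) = ∙-cong (⁻¹-cong (φ≈ψ i)) (eval-cong φ≈ψ w)

  eval-substituteWord : (φ : Fin m → Carrier) (W : Fin k → Word m) (u : Word k) →
                        eval H φ (substituteWord W u) ≈ eval H (λ j → eval H φ (W j)) u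
  eval-substituteWord φ W [] = refl
  eval-substituteWord φ W ((j , true) ∷ u) =
    trans (eval-++ φ (W j) _) (∙-congˡ (eval-substituteWord φ W u))
  eval-substituteWord φ W ((j , false) ∷ u) =
    trans (eval-++ φ (invertWord (W j)) _)
          (∙-cong (eval-invertWord φ (W j)) (eval-substituteWord φ W u))

  -- x_i = (x_i U⁻¹) U, and U is a product of the words W j.
  agree-on-generator : {φ ψ : Fin m → Carrier} (W : Fin k → Word m) (u : Word k) (i : Fin m) →
    (∀ j → eval H φ (W j) ≈ eval H ψ (W j)) →
    eval H φ ((i , true) ∷ invertWord (substituteWord W u)) ≈
      eval H ψ ((i , true) ∷ invertWord (substituteWord W u)) →
    φ i ≈ ψ i
  agree-on-generator {m = m} {φ = φ} {ψ} W u i agree-on-W agree-on-kernelWord =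
    ∙-cancelʳ _ _ _ (trans agree-on-kernelWord (∙-congˡ (sym agree-on-U⁻¹)))
    where
    U : Word m
    U = substituteWord W u
    agree-on-U⁻¹ : eval H φ (invertWord U) ≈ eval H ψ (invertWord U)
    agree-on-U⁻¹ = trans (eval-invertWord φ U) (trans (⁻¹-cong (trans
      (eval-substituteWord φ W u) (trans (eval-cong agree-on-W u)
      (sym (eval-substituteWord ψ W u)))))
      (sym (eval-invertWord ψ U)))

positionIn : (p : Subset k) {i : Fin k} → i ∈ˢ p → Fin ∣ p ∣
positionIn (inside  ∷ p) here        = zero
positionIn (inside  ∷ p) (there i∈p) = suc (positionIn p i∈p)
positionIn (outside ∷ p) (there i∈p) = positionIn p i∈p

positionIn-injective : (p : Subset k) {i j : Fin k} (i∈p : i ∈ˢ p) (j∈p : j ∈ˢ p) →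
                       positionIn p i∈p ≡ positionIn p j∈p → i ≡ j
positionIn-injective (inside  ∷ p) here        here        _  = ≡.refl
positionIn-injective (inside  ∷ p) (there i∈p) (there j∈p) eq =
  ≡.cong suc (positionIn-injective p i∈p j∈p (suc-injective eq))
positionIn-injective (outside ∷ p) (there i∈p) (there j∈p) eq =
  ≡.cong suc (positionIn-injective p i∈p j∈p eq)

module _ (H : FiniteGroup) where
  open FiniteGroup H

  indexOf : Carrier → Fin size
  indexOf x = proj₁ (enum-surj x)

  indexOf-injective : ∀ {x y} → indexOf x ≡ indexOf y → x ≈ y
  indexOf-injective {x} {y} eq =
    trans (sym (proj₂ (enum-surj x))) (trans (reflexive (≡.cong enum eq)) (proj₂ (enum-surj y)))

  memberIndex : (G : Subset size) → ∀ {x} → Mem H G x → Fin ∣ G ∣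
  memberIndex G (_ , i∈G , _) = positionIn G i∈G

  memberIndex-injective : (G : Subset size) → ∀ {x y} (x∈G : Mem H G x) (y∈G : Mem H G y) →
                          memberIndex G x∈G ≡ memberIndex G y∈G → x ≈ y
  memberIndex-injective G (i , i∈G , i↦x) (j , j∈G , j↦y) eq
    with positionIn-injective G i∈G j∈G eq
  ... | ≡.refl = trans (sym i↦x) j↦y

funToFin-injective : {f g : Fin m → Fin n} → funToFin f ≡ funToFin g → f ≗ g
funToFin-injective {f = f} {g} eq i = begin
  f i                      ≡⟨ finToFun-funToFin f i ⟨
  finToFun (funToFin f) i  ≡⟨ ≡.cong (λ c → finToFun c i) eq ⟩
  finToFun (funToFin g) i  ≡⟨ finToFun-funToFin g i ⟩
  g i                      ∎
  where open ≡.≡-Reasoning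

encode₃ : {a b c : ℕ} → (Fin k → Fin a) × (Fin m → Fin b) × (Fin n → Fin c) →
          Fin (a ^ k * b ^ m * c ^ n)
encode₃ (f , g , h) = combine (combine (funToFin f) (funToFin g)) (funToFin h)

encode₃-injective : {a b c : ℕ} (x y : (Fin k → Fin a) × (Fin m → Fin b) × (Fin n → Fin c)) →
  encode₃ x ≡ encode₃ y →
  proj₁ x ≗ proj₁ y × proj₁ (proj₂ x) ≗ proj₁ (proj₂ y) × proj₂ (proj₂ x) ≗ proj₂ (proj₂ y)
encode₃-injective (f , g , h) (f′ , g′ , h′) eq with combine-injective _ _ _ _ eq
... | fg≡ , h≡ with combine-injective _ _ _ _ fg≡
... | f≡ , g≡ = funToFin-injective f≡ , funToFin-injective g≡ , funToFin-injective h≡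

≗-lookup⇒≡ : {xs ys : Vec A n} → Vec.lookup xs ≗ Vec.lookup ys → xs ≡ ys
≗-lookup⇒≡ {xs = xs} {ys} eq = begin
  xs                        ≡⟨ tabulate∘lookup xs ⟨
  Vec.tabulate (Vec.lookup xs) ≡⟨ tabulate-cong eq ⟩
  Vec.tabulate (Vec.lookup ys) ≡⟨ tabulate∘lookup ys ⟩
  ys                        ∎
  where open ≡.≡-Reasoning

lookup-injective : {xs : List A} → Unique xs → ∀ {i j} → List.lookup xs i ≡ List.lookup xs j → i ≡ j
lookup-injective (x∉xs ∷ xs!) {zero}  {zero}  _  = ≡.refl
lookup-injective (x∉xs ∷ xs!) {zero}  {suc j} eq = ⊥-elim (All.lookup x∉xs (∈-lookup j) eq)
lookup-injective (x∉xs ∷ xs!) {suc i} {zero}  eq = ⊥-elim (All.lookup x∉xs (∈-lookup i) (≡.sym eq))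
lookup-injective (x∉xs ∷ xs!) {suc i} {suc j} eq = ≡.cong suc (lookup-injective xs! eq)

length≤-by-injection : {xs : List A} → Unique xs → (f : ∀ {x} → x ∈ xs → Fin N) →
                       (∀ {x y} (x∈xs : x ∈ xs) (y∈xs : y ∈ xs) → f x∈xs ≡ f y∈xs → x ≡ y) →
                       length xs ≤ N
length≤-by-injection xs! f f-injective =
  injective⇒≤ λ eq → lookup-injective xs! (f-injective (∈-lookup _) (∈-lookup _) eq)

lookupᵢ : {P : A → Set} {xs : List A} → DecidableEquality A → All P xs → ∀ x → .(x ∈ xs) → P x
lookupᵢ _≟_ (_∷_ {x = y} py pys) x x∈xs with y ≟ x
... | yes ≡.refl = py
... | no  y≢x    = lookupᵢ _≟_ pys x (Any.tail (λ x≡y → y≢x (≡.sym x≡y)) x∈xs)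

module Encoding (H₁ H₂ : FiniteGroup) (G₂ : Subset (FiniteGroup.size H₂))
                (t : Fin r → FiniteGroup.Carrier H₁) (t-generates : Generates H₁ t) where
  module H₁ = FiniteGroup H₁
  module H₂ = FiniteGroup H₂

  module Lift (v₁ : Vec (Fin H₁.size) n) (v₁-sur : IsSur H₁ v₁) where
    φ₁ : Fin n → H₁.Carrier
    φ₁ = hom H₁ v₁

    liftedGenerator : Fin r → Word n
    liftedGenerator j = proj₁ (v₁-sur (t j))

    liftedValue : Fin n → Word n
    liftedValue i = substituteWord liftedGenerator (proj₁ (t-generates (φ₁ i)))

    kernelWord : Fin n → Word n
    kernelWord i = (i , true) ∷ invertWord (liftedValue i)

    eval-liftedValue : ∀ i → eval H₁ φ₁ (liftedValue i) H₁.≈ φ₁ i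
    eval-liftedValue i = H₁.trans (eval-substituteWord H₁ φ₁ liftedGenerator u)
      (H₁.trans (eval-cong H₁ (λ j → proj₂ (v₁-sur (t j))) u) (proj₂ (t-generates (φ₁ i))))
      where
      u : Word r
      u = proj₁ (t-generates (φ₁ i))

    eval-kernelWord : ∀ i → eval H₁ φ₁ (kernelWord i) H₁.≈ H₁.ε
    eval-kernelWord i = H₁.trans
      (H₁.∙-congˡ (H₁.trans (eval-invertWord H₁ φ₁ (liftedValue i))
                             (H₁.⁻¹-cong (eval-liftedValue i))))
      (H₁.inverseʳ _)

  open Lift using (liftedGenerator; kernelWord; eval-kernelWord)

  module _ (v₁ : Vec (Fin H₁.size) n) (v₁-sur : IsSur H₁ v₁)
           (v₂ : Vec (Fin H₂.size) n) (kerImage : ImageOfKernelIs H₂ H₁ v₂ v₁ G₂) where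
    kernelWord-image : ∀ i → Mem H₂ G₂ (eval H₂ (hom H₂ v₂) (kernelWord v₁ v₁-sur i))
    kernelWord-image i = Equivalence.from (kerImage _)
      (kernelWord v₁ v₁-sur i , eval-kernelWord v₁ v₁-sur i , H₂.refl)

    components : (Fin n → Fin H₁.size) × (Fin n → Fin ∣ G₂ ∣) × (Fin r → Fin H₂.size)
    components = Vec.lookup v₁
               , (λ i → memberIndex H₂ G₂ (kernelWord-image i))
               , (λ j → indexOf H₂ (eval H₂ (hom H₂ v₂) (liftedGenerator v₁ v₁-sur j)))

    code : Fin (H₁.size ^ n * ∣ G₂ ∣ ^ n * H₂.size ^ r)
    code = encode₃ components

  code-determines-φ₁ : ∀ (v₁ v₁′ : Vec (Fin H₁.size) n) v₂ v₂′
    (v₁-sur : IsSur H₁ v₁) (v₁′-sur : IsSur H₁ v₁′)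
    (kerImage : ImageOfKernelIs H₂ H₁ v₂ v₁ G₂) (kerImage′ : ImageOfKernelIs H₂ H₁ v₂′ v₁′ G₂) →
    code v₁ v₁-sur v₂ kerImage ≡ code v₁′ v₁′-sur v₂′ kerImage′ → v₁ ≡ v₁′
  code-determines-φ₁ v₁ v₁′ v₂ v₂′ v₁-sur v₁′-sur kerImage kerImage′ eq =
    ≗-lookup⇒≡ (proj₁ (encode₃-injective (components v₁ v₁-sur v₂ kerImage)
                                         (components v₁′ v₁′-sur v₂′ kerImage′) eq))

  code-determines-φ₂ : ∀ (v₁ : Vec (Fin H₁.size) n) v₂ v₂′ (v₁-sur : IsSur H₁ v₁)
    (kerImage : ImageOfKernelIs H₂ H₁ v₂ v₁ G₂) (kerImage′ : ImageOfKernelIs H₂ H₁ v₂′ v₁ G₂) →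
    code v₁ v₁-sur v₂ kerImage ≡ code v₁ v₁-sur v₂′ kerImage′ → v₂ ≡ v₂′
  code-determines-φ₂ v₁ v₂ v₂′ v₁-sur kerImage kerImage′ eq
    with encode₃-injective (components v₁ v₁-sur v₂ kerImage) (components v₁ v₁-sur v₂′ kerImage′) eq
  ... | _ , kernelWord-indices≗ , liftedGenerator-indices≗ = ≗-lookup⇒≡ λ i →
    H₂.enum-inj _ _ (agree-on-generator H₂ {φ = hom H₂ v₂} {hom H₂ v₂′}
      (liftedGenerator v₁ v₁-sur) (proj₁ (t-generates (hom H₁ v₁ i))) i
      (λ j → indexOf-injective H₂ (liftedGenerator-indices≗ j))
      (memberIndex-injective H₂ G₂ (kernelWord-image v₁ v₁-sur v₂ kerImage i)
        (kernelWord-image v₁ v₁-sur v₂′ kerImage′ i) (kernelWord-indices≗ i)))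

lemma4p2 : (H₁ H₂ : FiniteGroup) (n : ℕ)
    → (G₁ : Subset (FiniteGroup.size H₁)) → IsNormalSubgroup H₁ G₁
    → (G₂ : Subset (FiniteGroup.size H₂)) → IsNormalSubgroup H₂ G₂
    → (r : ℕ) → IsRank H₁ r
    → (S : List (Vec (Fin (FiniteGroup.size H₁)) n × Vec (Fin (FiniteGroup.size H₂)) n))
    → Unique S
    → All (InS H₁ H₂ G₁ G₂ n) S
    → length S ≤ (order H₁ ^ n) * (card G₂ ^ n) * (order H₂ ^ r)
lemma4p2 H₁ H₂ n G₁ _ G₂ _ r ((t , t-generates) , _) S S-unique S⊆InS =
  length≤-by-injection S-unique encode encode-injective
  where
  open Encoding H₁ H₂ G₂ t t-generates

  -- The lifts of the generators of H₁ must depend on φ₁ alone, so the surjectivity witness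
  -- for φ₁ is looked up by φ₁ itself rather than taken from the pair.
  surjective : ∀ {v₁ v₂} → (v₁ , v₂) ∈ S → IsSur H₁ v₁
  surjective {v₁} p∈S =
    lookupᵢ (≡-dec Fin._≟_) (All.map⁺ (All.map proj₁ S⊆InS)) v₁ (∈-map⁺ proj₁ p∈S)

  kernelImage : ∀ {v₁ v₂} → (v₁ , v₂) ∈ S → ImageOfKernelIs H₂ H₁ v₂ v₁ G₂
  kernelImage p∈S = proj₂ (proj₂ (proj₂ (All.lookup S⊆InS p∈S)))

  encode : ∀ {p} → p ∈ S → Fin (order H₁ ^ n * card G₂ ^ n * order H₂ ^ r)
  encode {v₁ , v₂} p∈S = code v₁ (surjective p∈S) v₂ (kernelImage p∈S)

  encode-injective : ∀ {p q} (p∈S : p ∈ S) (q∈S : q ∈ S) → encode p∈S ≡ encode q∈S → p ≡ q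
  encode-injective {v₁ , v₂} {v₁′ , v₂′} p∈S q∈S eq
    with code-determines-φ₁ v₁ v₁′ v₂ v₂′ (surjective p∈S) (surjective q∈S)
                            (kernelImage p∈S) (kernelImage q∈S) eq
  ... | ≡.refl = ≡.cong (v₁ ,_)
    (code-determines-φ₂ v₁ v₂ v₂′ (surjective p∈S) (kernelImage p∈S) (kernelImage q∈S) eq)
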